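{- Let $l\ge 1$ and let $G$ be a connected graph with $|E(G)|-|V(G)|=l-1$ (equivalently, with $l$ edges outside a spanning tree). Then the probability that a random $n$-lift of $G$ is connected equals the probability that $l$ independent, uniformly random elements of $\mathcal{S}_n$ generate a transitive subgroup of $\mathcal{S}_n$.
   Context: A random $n$-lift $\tilde G$ of a graph $G$: orient the edges of $G$ arbitrarily and assign to each edge $e$ a permutation $\pi_e\in\mathcal{S}_n$, independently and uniformly at random; $\tilde G$ has vertex set $V(G)\times\{1,\dots,n\}$, with $(u,i)$ joined to $(v,j)$ iff there is an edge $e$ oriented from $u$ to $v$ with $\pi_e(i)=j$. -}

module Defs where

open import Data.Nat using (ℕ; zero; suc)
open import Data.Fin using (Fin)
open import Data.Fin.Properties using (_≟_)
open import Data.Product using (_×_; _,_; ∃; ∃-syntax)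
open import Data.List using (List; []; _∷_; [_]; map; concatMap; filter; allFin)
open import Data.Vec using (Vec; lookup; toList) renaming ([] to []ᵥ; _∷_ to _∷ᵥ_)
import Data.List.Relation.Unary.Unique.DecPropositional as UniqueDec
open import Relation.Binary.PropositionalEquality using (_≡_; _≢_)
open import Relation.Binary.Construct.Closure.ReflexiveTransitive using (Star)
open import Relation.Binary.Construct.Closure.Symmetric using (SymClosure)
open import Relation.Nullary using (¬_)
open import Function using (id; _∘_)

Connected : {A : Set} → (A → A → Set) → Set
Connected {A} Adj = (x y : A) → Star (SymClosure Adj) x y

-- A (multi)graph G on vertex set Fin V with m edges; edge e is oriented
-- from proj₁ (E e) to proj₂ (E e).
EdgeAdj : {V m : ℕ} → (Fin m → Fin V × Fin V) → Fin V → Fin V → Set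
EdgeAdj {V} {m} E u v = ∃[ e ] E e ≡ (u , v)

Simple : {V m : ℕ} → (Fin m → Fin V × Fin V) → Set
Simple {V} {m} E =
  ((e : Fin m) (u : Fin V) → E e ≢ (u , u)) ×
  ((e f : Fin m) (u v : Fin V) → E e ≡ (u , v) →
      (E f ≡ (u , v) → e ≡ f) × (E f ≡ (v , u) → e ≡ f))

-- Permutations of Fin n in one-line notation: a permutation σ is a vector
-- with σ(i) = lookup σ i, all entries distinct.

Perm : ℕ → Set
Perm n = Vec (Fin n) n

vecsOf : {A : Set} → List A → (k : ℕ) → List (Vec A k)
vecsOf xs zero = [ []ᵥ ]
vecsOf xs (suc k) = concatMap (λ x → map (x ∷ᵥ_) (vecsOf xs k)) xs

perms : (n : ℕ) → List (Perm n)
perms n = filter (λ v → UniqueDec.unique? (_≟_ {n}) (toList v)) (vecsOf (allFin n) n)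

LiftAdj : {V m n : ℕ} → (Fin m → Fin V × Fin V) → Vec (Perm n) m →
          Fin V × Fin n → Fin V × Fin n → Set
LiftAdj {V} {m} {n} E σ (u , i) (v , j) =
  ∃[ e ] (E e ≡ (u , v) × lookup (lookup σ e) i ≡ j)

data InGen {n l : ℕ} (τ : Vec (Perm n) l) : (Fin n → Fin n) → Set where
  gen  : (k : Fin l) → InGen τ (lookup (lookup τ k))
  one  : InGen τ id
  comp : {f g : Fin n → Fin n} → InGen τ f → InGen τ g → InGen τ (f ∘ g)
  inv  : {f h : Fin n → Fin n} → InGen τ f →
         ((x : Fin n) → f (h x) ≡ x) → ((x : Fin n) → h (f x) ≡ x) →
         InGen τ h

GeneratesTransitive : {n l : ℕ} → Vec (Perm n) l → Set
GeneratesTransitive {n} τ = (i j : Fin n) → ∃[ f ] (InGen τ f × f i ≡ j)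

data Count {A : Set} (P : A → Set) : List A → ℕ → Set where
  []  : Count P [] zero
  yes : {x : A} {xs : List A} {k : ℕ} → P x → Count P xs k → Count P (x ∷ xs) (suc k)
  no  : {x : A} {xs : List A} {k : ℕ} → ¬ P x → Count P xs k → Count P (x ∷ xs) k

module Submission where

-- Proof by induction on the number of vertices.  With one vertex every edge
-- is a loop; a walk in the lift is then a word in the edge permutations and
-- their inverses, so the lift is connected iff the permutations generate a
-- transitive group (here l = |E(G)|).  Otherwise G has a non-loop edge
-- e₀ = (u , v).  Relabelling the fibre over v by the permutation s on e₀
-- turns the e₀-edges of the lift into identifications, which exhibits a
-- bijection (s , τ) ↦ σ between S_n × S_n^E(G/e₀) and S_n^E(G) under which
-- the lift of G by σ is connected iff the lift of G/e₀ by τ is.  Hence the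
-- connected lifts of G are n! times those of G/e₀, and G/e₀ satisfies the
-- same hypothesis with the same l.

open import Defs
open import Data.Nat using (ℕ; zero; suc; _+_; _*_; _^_; _≤_)
open import Data.Fin using (Fin; zero; suc; punchIn; punchOut)
open import Data.Fin.Properties
  using (_≟_; any?; punchInᵢ≢i; punchOut-cong; punchOut-punchIn; punchIn-punchOut; punchOut-injective; injective⇒≤)
open import Data.Nat.Properties using (1+n≰n; suc-injective; +-comm; *-assoc; *-commutativeSemigroup)
open import Algebra.Properties.CommutativeSemigroup *-commutativeSemigroup using (x∙yz≈y∙xz)
open import Data.Product using (∃; ∃₂; _×_; _,_; proj₁; proj₂)
open import Data.Empty using (⊥-elim)
open import Data.Sum using (_⊎_; inj₁; inj₂)
import Data.List as List
open import Data.List using (List; []; _∷_; _++_; length; map; concatMap; cartesianProductWith; allFin)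
open import Data.List.Properties using (map-∘; map-id-local)
open import Data.List.Membership.Propositional using (_∈_)
open import Data.List.Membership.Propositional.Properties
  using (∈-map⁺; ∈-map⁻; ∈-filter⁺; ∈-filter⁻; ∈-allFin; ∈-cartesianProductWith⁺; ∈-cartesianProductWith⁻)
open import Data.List.Membership.Propositional.Properties.WithK using (unique∧set⇒bag)
open import Data.List.Relation.Binary.BagAndSetEquality using (∼bag⇒↭)
open import Data.List.Relation.Binary.Permutation.Propositional
  using (_↭_; ↭-sym; prep; swap) renaming (refl to ↭-refl; trans to ↭-trans)
open import Data.List.Relation.Unary.All as All using ([]; _∷_)
open import Data.List.Relation.Unary.Any using (here; there)
open import Data.List.Relation.Unary.AllPairs using ([]; _∷_)
open import Data.List.Relation.Unary.Unique.Propositional using (Unique)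
import Data.List.Relation.Unary.Unique.Propositional.Properties as UniqueP
import Data.List.Relation.Unary.Unique.DecPropositional as UniqueDec
open import Data.Vec using (Vec; lookup; tabulate; toList; insertAt; removeAt) renaming ([] to []ᵥ; _∷_ to _∷ᵥ_)
open import Data.Vec.Properties using (∷-injective; lookup∘tabulate; tabulate∘lookup; tabulate-cong;
         insertAt-lookup; insertAt-punchIn; removeAt-insertAt; insertAt-removeAt; removeAt-punchOut)
open import Function using (_∘_)
open import Function.Definitions using (Injective)
open import Function.Bundles using (_⇔_; mk⇔; Equivalence)
open import Relation.Binary.PropositionalEquality using (_≡_; _≢_; refl; sym; trans; cong; cong₂; subst; subst₂; module ≡-Reasoning)
open import Relation.Binary.Construct.Closure.ReflexiveTransitive as Star using (Star; ε; _◅_; _◅◅_)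
open import Relation.Binary.Construct.Closure.Symmetric using (SymClosure; fwd; bwd; symmetric)
open import Relation.Nullary using (Dec)
import Relation.Nullary.Decidable.Core as Dec
open ≡-Reasoning

module _ {A : Set} where

  Count-functional : ∀ {P : A → Set} {xs a b} → Count P xs a → Count P xs b → a ≡ b
  Count-functional []         []          = refl
  Count-functional (yes _ c)  (yes _ c′)  = cong suc (Count-functional c c′)
  Count-functional (yes p _)  (no ¬p _)   = ⊥-elim (¬p p)
  Count-functional (no ¬p _)  (yes p _)   = ⊥-elim (¬p p)
  Count-functional (no _ c)   (no _ c′)   = Count-functional c c′

  Count-cong : ∀ {P Q : A → Set} {xs a} → (∀ {x} → x ∈ xs → P x ⇔ Q x) →
               Count P xs a → Count Q xs a
  Count-cong P⇔Q []         = []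
  Count-cong P⇔Q (yes p c)  = yes (Equivalence.to (P⇔Q (here refl)) p) (Count-cong (P⇔Q ∘ there) c)
  Count-cong P⇔Q (no ¬p c)  = no (¬p ∘ Equivalence.from (P⇔Q (here refl))) (Count-cong (P⇔Q ∘ there) c)

  Count-++⁻ : ∀ {P : A → Set} (xs : List A) {ys a} → Count P (xs ++ ys) a →
              ∃₂ λ a₁ a₂ → Count P xs a₁ × Count P ys a₂ × a ≡ a₁ + a₂
  Count-++⁻ []        c          = 0 , _ , [] , c , refl
  Count-++⁻ (x ∷ xs)  (yes p c)  with a₁ , a₂ , c₁ , c₂ , eq ← Count-++⁻ xs c =
    suc a₁ , a₂ , yes p c₁ , c₂ , cong suc eq
  Count-++⁻ (x ∷ xs)  (no ¬p c)  with a₁ , a₂ , c₁ , c₂ , eq ← Count-++⁻ xs c =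
    a₁ , a₂ , no ¬p c₁ , c₂ , eq

  Count-↭ : ∀ {P : A → Set} {xs ys a} → xs ↭ ys → Count P xs a → Count P ys a
  Count-↭ ↭-refl                c                  = c
  Count-↭ (prep x xs↭ys)         (yes p c)          = yes p (Count-↭ xs↭ys c)
  Count-↭ (prep x xs↭ys)         (no ¬p c)          = no ¬p (Count-↭ xs↭ys c)
  Count-↭ (swap x y xs↭ys)       (yes p (yes q c))  = yes q (yes p (Count-↭ xs↭ys c))
  Count-↭ (swap x y xs↭ys)       (yes p (no ¬q c))  = no ¬q (yes p (Count-↭ xs↭ys c))
  Count-↭ (swap x y xs↭ys)       (no ¬p (yes q c))  = yes q (no ¬p (Count-↭ xs↭ys c))
  Count-↭ (swap x y xs↭ys)       (no ¬p (no ¬q c))  = no ¬q (no ¬p (Count-↭ xs↭ys c))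
  Count-↭ (↭-trans xs↭ys ys↭zs)  c                  = Count-↭ ys↭zs (Count-↭ xs↭ys c)

  Count-map⁻ : ∀ {B : Set} {P : B → Set} (f : A → B) xs {a} →
               Count P (map f xs) a → Count (P ∘ f) xs a
  Count-map⁻ f []        []         = []
  Count-map⁻ f (x ∷ xs)  (yes p c)  = yes p (Count-map⁻ f xs c)
  Count-map⁻ f (x ∷ xs)  (no ¬p c)  = no ¬p (Count-map⁻ f xs c)

  Count-bijection : ∀ {P : A → Set} {xs a} (F G : A → A) → Unique xs →
    (∀ {x} → x ∈ xs → F x ∈ xs) → (∀ {x} → x ∈ xs → G x ∈ xs) →
    (∀ {x} → x ∈ xs → F (G x) ≡ x) → (∀ {x} → x ∈ xs → G (F x) ≡ x) →
    Count P xs a → Count (P ∘ G) xs a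
  Count-bijection {xs = xs} F G xs! F∈ G∈ FG GF c =
    Count-map⁻ G xs (Count-↭ (↭-sym (∼bag⇒↭ (unique∧set⇒bag Gxs! xs! same))) c)
    where
    FGxs≡xs : map F (map G xs) ≡ xs
    FGxs≡xs = trans (sym (map-∘ xs)) (map-id-local (All.tabulate FG))
    Gxs! : Unique (map G xs)
    Gxs! = UniqueP.map⁻ (subst Unique (sym FGxs≡xs) xs!)
    same : ∀ {z} → (z ∈ map G xs) ⇔ (z ∈ xs)
    same = mk⇔ (λ z∈ → let x , x∈ , z≡Gx = ∈-map⁻ G z∈ in subst (_∈ xs) (sym z≡Gx) (G∈ x∈))
               (λ z∈ → subst (_∈ map G xs) (GF z∈) (∈-map⁺ G (F∈ z∈)))

module _ {A B C : Set} (f : A → B → C) {Q : C → Set} {Q′ : B → Set}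
         (xs : List A) (ys : List B)
         (Q⇔Q′ : ∀ {x y} → x ∈ xs → y ∈ ys → Q (f x y) ⇔ Q′ y) where

  Count-product : ∀ {a c} → Count Q′ ys c →
                  Count Q (cartesianProductWith f xs ys) a → a ≡ length xs * c
  Count-product = count xs (λ x∈ → x∈)
    where
    count : ∀ zs → (∀ {x} → x ∈ zs → x ∈ xs) → ∀ {a c} → Count Q′ ys c →
            Count Q (cartesianProductWith f zs ys) a → a ≡ length zs * c
    count []       _   cQ′ []   = refl
    count (z ∷ zs) ⊆xs cQ′ cQ
      with a₁ , a₂ , c₁ , c₂ , refl ← Count-++⁻ (map (f z) ys) cQ =
      cong₂ _+_ (Count-functional (Count-cong (Q⇔Q′ (⊆xs (here refl))) (Count-map⁻ (f z) ys c₁)) cQ′)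
                (count zs (⊆xs ∘ there) cQ′ c₂)

  -- When xs is nonempty the count on ys exists (Q′ need not be decidable).
  Count-product-factor : ∀ {x a} → x ∈ xs →
                         Count Q (cartesianProductWith f xs ys) a → ∃ λ c → Count Q′ ys c
  Count-product-factor = factor xs (λ x∈ → x∈)
    where
    factor : ∀ zs → (∀ {x} → x ∈ zs → x ∈ xs) → ∀ {x a} → x ∈ zs →
             Count Q (cartesianProductWith f zs ys) a → ∃ λ c → Count Q′ ys c
    factor (z ∷ zs) ⊆xs (here refl) cQ
      with a₁ , _ , c₁ , _ ← Count-++⁻ (map (f z) ys) cQ =
      a₁ , Count-cong (Q⇔Q′ (⊆xs (here refl))) (Count-map⁻ (f z) ys c₁)
    factor (z ∷ zs) ⊆xs (there x∈) cQ
      with _ , _ , _ , c₂ , _ ← Count-++⁻ (map (f z) ys) cQ =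
      factor zs (⊆xs ∘ there) x∈ c₂

vecsOf-suc : ∀ {A : Set} (xs : List A) k →
             vecsOf xs (suc k) ≡ cartesianProductWith _∷ᵥ_ xs (vecsOf xs k)
vecsOf-suc xs k = blocks xs
  where
  blocks : ∀ zs → concatMap (λ z → map (z ∷ᵥ_) (vecsOf xs k)) zs
                  ≡ cartesianProductWith _∷ᵥ_ zs (vecsOf xs k)
  blocks []       = refl
  blocks (z ∷ zs) = cong (map (z ∷ᵥ_) (vecsOf xs k) ++_) (blocks zs)

∈-vecsOf⁻ : ∀ {A : Set} {xs : List A} {k} {v : Vec A k} → v ∈ vecsOf xs k → ∀ i → lookup v i ∈ xs
∈-vecsOf⁻ {xs = xs} {suc k} {x ∷ᵥ v} v∈ i
  with y , w , y∈ , w∈ , eq ← ∈-cartesianProductWith⁻ _∷ᵥ_ xs (vecsOf xs k)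
                                (subst (_ ∈_) (vecsOf-suc xs k) v∈)
  with refl , refl ← ∷-injective eq
  with i
... | zero  = y∈
... | suc j = ∈-vecsOf⁻ w∈ j

∈-vecsOf⁺ : ∀ {A : Set} {xs : List A} {k} {v : Vec A k} → (∀ i → lookup v i ∈ xs) → v ∈ vecsOf xs k
∈-vecsOf⁺ {k = zero}  {[]ᵥ}     _   = here refl
∈-vecsOf⁺ {xs = xs} {suc k} {x ∷ᵥ v} ∈xs =
  subst (_ ∈_) (sym (vecsOf-suc xs k))
        (∈-cartesianProductWith⁺ _∷ᵥ_ (∈xs zero) (∈-vecsOf⁺ (∈xs ∘ suc)))

vecsOf-unique : ∀ {A : Set} {xs : List A} k → Unique xs → Unique (vecsOf xs k)
vecsOf-unique zero xs! = [] ∷ []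
vecsOf-unique {xs = xs} (suc k) xs! =
  subst Unique (sym (vecsOf-suc xs k))
        (UniqueP.cartesianProductWith⁺ _∷ᵥ_ ∷-injective xs! (vecsOf-unique k xs!))

module _ {A : Set} where

  lookup∈toList : ∀ {k} (v : Vec A k) i → lookup v i ∈ toList v
  lookup∈toList (x ∷ᵥ v) zero    = here refl
  lookup∈toList (x ∷ᵥ v) (suc i) = there (lookup∈toList v i)

  toList-unique⇒lookup-injective : ∀ {k} (v : Vec A k) → Unique (toList v) → Injective _≡_ _≡_ (lookup v)
  toList-unique⇒lookup-injective (x ∷ᵥ v) (x∉ ∷ v!) {zero}  {zero}  _  = refl
  toList-unique⇒lookup-injective (x ∷ᵥ v) (x∉ ∷ v!) {zero}  {suc j} eq = ⊥-elim (All.lookup x∉ (lookup∈toList v j) eq)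
  toList-unique⇒lookup-injective (x ∷ᵥ v) (x∉ ∷ v!) {suc i} {zero}  eq = ⊥-elim (All.lookup x∉ (lookup∈toList v i) (sym eq))
  toList-unique⇒lookup-injective (x ∷ᵥ v) (x∉ ∷ v!) {suc i} {suc j} eq = cong suc (toList-unique⇒lookup-injective v v! eq)

  toList≡tabulate : ∀ {k} (v : Vec A k) → toList v ≡ List.tabulate (lookup v)
  toList≡tabulate []ᵥ      = refl
  toList≡tabulate (x ∷ᵥ v) = cong (x ∷_) (toList≡tabulate v)

  lookup-injective⇒toList-unique : ∀ {k} (v : Vec A k) → Injective _≡_ _≡_ (lookup v) → Unique (toList v)
  lookup-injective⇒toList-unique v inj = subst Unique (sym (toList≡tabulate v)) (UniqueP.tabulate⁺ inj)

distinct? : ∀ {n} (v : Perm n) → Dec (Unique (toList v))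
distinct? {n} v = UniqueDec.unique? (_≟_ {n}) (toList v)

perms-unique : ∀ n → Unique (perms n)
perms-unique n = UniqueP.filter⁺ distinct? (vecsOf-unique n (UniqueP.allFin⁺ n))

∈-perms⁻ : ∀ {n} {σ : Perm n} → σ ∈ perms n → Injective _≡_ _≡_ (lookup σ)
∈-perms⁻ {n} σ∈ = toList-unique⇒lookup-injective _ (proj₂ (∈-filter⁻ distinct? {xs = vecsOf (allFin n) n} σ∈))

∈-perms⁺ : ∀ {n} {σ : Perm n} → Injective _≡_ _≡_ (lookup σ) → σ ∈ perms n
∈-perms⁺ {σ = σ} inj =
  ∈-filter⁺ distinct? (∈-vecsOf⁺ (λ i → ∈-allFin _)) (lookup-injective⇒toList-unique σ inj)

tabulate∈perms : ∀ {n} {f : Fin n → Fin n} → Injective _≡_ _≡_ f → tabulate f ∈ perms n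
tabulate∈perms {f = f} inj = ∈-perms⁺ λ {i} {j} eq →
  inj (trans (sym (lookup∘tabulate f i)) (trans eq (lookup∘tabulate f j)))

-- An injective endomap of Fin n is surjective (otherwise it would inject
-- Fin n into Fin (n - 1) after punching out a missed value).
injective⇒surjective : ∀ {n} (f : Fin n → Fin n) → Injective _≡_ _≡_ f → ∀ j → ∃ λ i → f i ≡ j
injective⇒surjective {suc n} f inj j with any? (λ i → f i ≟ j)
... | Dec.yes hit = hit
... | Dec.no miss = ⊥-elim (1+n≰n (injective⇒≤ squeezeInjective))
  where
  squeeze : Fin (suc n) → Fin n
  squeeze i = punchOut {i = j} {j = f i} (λ j≡fi → miss (i , sym j≡fi))
  squeezeInjective : Injective _≡_ _≡_ squeeze
  squeezeInjective {x} {y} eq =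
    inj (punchOut-injective (λ e → miss (x , sym e)) (λ e → miss (y , sym e)) eq)

-- The inverse of a permutation (defined by search; only meaningful on perms n).
inverse : ∀ {n} → Perm n → Fin n → Fin n
inverse σ j with any? (λ i → lookup σ i ≟ j)
... | Dec.yes (i , _) = i
... | Dec.no _        = j

inverseʳ : ∀ {n} {σ : Perm n} → σ ∈ perms n → ∀ j → lookup σ (inverse σ j) ≡ j
inverseʳ {σ = σ} σ∈ j with any? (λ i → lookup σ i ≟ j)
... | Dec.yes (i , σi≡j) = σi≡j
... | Dec.no miss        = ⊥-elim (miss (injective⇒surjective (lookup σ) (∈-perms⁻ σ∈) j))

inverseˡ : ∀ {n} {σ : Perm n} → σ ∈ perms n → ∀ i → inverse σ (lookup σ i) ≡ i
inverseˡ σ∈ i = ∈-perms⁻ σ∈ (inverseʳ σ∈ _)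

relabel : ∀ {n} → (Fin n → Fin n) → (Fin n → Fin n) → Perm n → Perm n
relabel a b π = tabulate (a ∘ lookup π ∘ b)

lookup-relabel : ∀ {n} (a b : Fin n → Fin n) (π : Perm n) i → lookup (relabel a b π) i ≡ a (lookup π (b i))
lookup-relabel a b π = lookup∘tabulate (a ∘ lookup π ∘ b)

relabel-relabel : ∀ {n} {a a′ b b′ : Fin n → Fin n} (π : Perm n) →
                  (∀ i → a (a′ i) ≡ i) → (∀ i → b′ (b i) ≡ i) → relabel a b (relabel a′ b′ π) ≡ π
relabel-relabel {a = a} {a′} {b} {b′} π aa′ b′b = begin
  tabulate (a ∘ lookup (relabel a′ b′ π) ∘ b)  ≡⟨ tabulate-cong undo ⟩
  tabulate (lookup π)                          ≡⟨ tabulate∘lookup π ⟩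
  π                                            ∎
  where
  undo : ∀ i → a (lookup (relabel a′ b′ π) (b i)) ≡ lookup π i
  undo i = begin
    a (lookup (relabel a′ b′ π) (b i))  ≡⟨ cong a (lookup-relabel a′ b′ π (b i)) ⟩
    a (a′ (lookup π (b′ (b i))))        ≡⟨ aa′ _ ⟩
    lookup π (b′ (b i))                 ≡⟨ cong (lookup π) (b′b i) ⟩
    lookup π i                          ∎

relabel∈perms : ∀ {n} {a b : Fin n → Fin n} {π : Perm n} →
                Injective _≡_ _≡_ a → Injective _≡_ _≡_ b → π ∈ perms n → relabel a b π ∈ perms n
relabel∈perms {a = a} {b} {π} a-inj b-inj π∈ =
  ∈-perms⁺ λ {i} {j} eq → b-inj (∈-perms⁻ π∈ (a-inj (begin
    a (lookup π (b i))        ≡⟨ lookup-relabel a b π i ⟨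
    lookup (relabel a b π) i  ≡⟨ eq ⟩
    lookup (relabel a b π) j  ≡⟨ lookup-relabel a b π j ⟩
    a (lookup π (b j))        ∎)))

lookup-removeAt : ∀ {A : Set} {k} (v : Vec A (suc k)) i j → lookup (removeAt v i) j ≡ lookup v (punchIn i j)
lookup-removeAt v i j = begin
  lookup (removeAt v i) j                                  ≡⟨ cong (lookup (removeAt v i)) (punchOut-punchIn i) ⟨
  lookup (removeAt v i) (punchOut (punchInᵢ≢i i j ∘ sym))  ≡⟨ removeAt-punchOut v (punchInᵢ≢i i j ∘ sym) ⟩
  lookup v (punchIn i j)                                   ∎

Walk : {A : Set} → (A → A → Set) → A → A → Set
Walk R = Star (SymClosure R)

walk-reverse : ∀ {A : Set} {R : A → A → Set} {x y} → Walk R x y → Walk R y x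
walk-reverse {R = R} = Star.reverse (symmetric R)

module _ {A B : Set} {R : A → A → Set} {S : B → B → Set} (φ : A → B) where

  map-walk : (∀ {x y} → R x y → Walk S (φ x) (φ y)) → ∀ {x y} → Walk R x y → Walk S (φ x) (φ y)
  map-walk edge ε             = ε
  map-walk edge (fwd r ◅ rs)  = edge r ◅◅ map-walk edge rs
  map-walk edge (bwd r ◅ rs)  = walk-reverse (edge r) ◅◅ map-walk edge rs

  connected-image : (∀ {x y} → R x y → Walk S (φ x) (φ y)) →
                    (ψ : B → A) → (∀ b → φ (ψ b) ≡ b) → Connected R → Connected S
  connected-image edge ψ φψ connR b b′ =
    subst₂ (Walk S) (φψ b) (φψ b′) (map-walk edge (connR (ψ b) (ψ b′)))

  connected-preimage : (∀ {b b′} → S b b′ → ∃₂ λ x y → R x y × φ x ≡ b × φ y ≡ b′) →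
                       (∀ {x y} → φ x ≡ φ y → Walk R x y) → Connected S → Connected R
  connected-preimage lift fibre connS x y = pull (connS (φ x) (φ y)) refl refl
    where
    pull : ∀ {b b′} → Walk S b b′ → ∀ {x y} → φ x ≡ b → φ y ≡ b′ → Walk R x y
    pull ε            x↦ y↦ = fibre (trans x↦ (sym y↦))
    pull (fwd s ◅ ss) x↦ y↦ with x′ , y′ , r , x′↦ , y′↦ ← lift s =
      fibre (trans x↦ (sym x′↦)) ◅◅ fwd r ◅ pull ss y′↦ y↦
    pull (bwd s ◅ ss) x↦ y↦ with x′ , y′ , r , x′↦ , y′↦ ← lift s =
      fibre (trans x↦ (sym y′↦)) ◅◅ bwd r ◅ pull ss x′↦ y↦

walk⇒non-loop : ∀ {V m} {E : Fin m → Fin V × Fin V} {x y} → Walk (EdgeAdj E) x y → x ≢ y →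
                ∃ λ e → proj₁ (E e) ≢ proj₂ (E e)
walk⇒non-loop ε x≢x = ⊥-elim (x≢x refl)
walk⇒non-loop {E = E} (fwd (e , Ee≡xz) ◅ w) x≢y with proj₁ (E e) ≟ proj₂ (E e)
... | Dec.no  non-loop = e , non-loop
... | Dec.yes loop     = walk⇒non-loop w λ z≡y →
  x≢y (trans (sym (cong proj₁ Ee≡xz)) (trans loop (trans (cong proj₂ Ee≡xz) z≡y)))
walk⇒non-loop {E = E} (bwd (e , Ee≡zx) ◅ w) x≢y with proj₁ (E e) ≟ proj₂ (E e)
... | Dec.no  non-loop = e , non-loop
... | Dec.yes loop     = walk⇒non-loop w λ z≡y →
  x≢y (trans (sym (cong proj₂ Ee≡zx)) (trans (sym loop) (trans (cong proj₁ Ee≡zx) z≡y)))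

-- Every edge is a loop at the unique vertex, so a
-- walk in the n-lift is a word in the edge permutations and their inverses:
-- the lift is connected iff these permutations generate a transitive group.
module OneVertexLift {n m : ℕ} (E : Fin m → Fin 1 × Fin 1) (σ : Vec (Perm n) m) where

  loop : ∀ e → E e ≡ (zero , zero)
  loop e with E e
  ... | zero , zero = refl

  InGen⇒walk : ∀ {f} → InGen σ f → ∀ i → Walk (LiftAdj E σ) (zero , i) (zero , f i)
  InGen⇒walk (gen e)               i = fwd (e , loop e , refl) ◅ ε
  InGen⇒walk one                   i = ε
  InGen⇒walk (comp {g = g} f∈ g∈)  i = InGen⇒walk g∈ i ◅◅ InGen⇒walk f∈ (g i)
  InGen⇒walk (inv {h = h} f∈ fh _) i =
    walk-reverse (subst (Walk (LiftAdj E σ) (zero , h i) ∘ (zero ,_)) (fh i) (InGen⇒walk f∈ (h i)))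

  transitive⇒connected : GeneratesTransitive σ → Connected (LiftAdj E σ)
  transitive⇒connected transitive (zero , i) (zero , j) with f , f∈ , fi≡j ← transitive i j =
    subst (Walk (LiftAdj E σ) (zero , i) ∘ (zero ,_)) fi≡j (InGen⇒walk f∈ i)

  module _ (σ∈ : ∀ e → lookup σ e ∈ perms n) where

    walk⇒InGen : ∀ {x y} → Walk (LiftAdj E σ) x y → ∃ λ f → InGen σ f × f (proj₂ x) ≡ proj₂ y
    walk⇒InGen ε = (λ i → i) , one , refl
    walk⇒InGen (fwd (e , _ , σₑi≡j) ◅ w) with g , g∈ , gj≡k ← walk⇒InGen w =
      g ∘ lookup (lookup σ e) , comp g∈ (gen e) , trans (cong g σₑi≡j) gj≡k
    walk⇒InGen (bwd (e , _ , σₑj≡i) ◅ w) with g , g∈ , gj≡k ← walk⇒InGen w =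
      g ∘ inverse (lookup σ e) ,
      comp g∈ (inv (gen e) (inverseʳ (σ∈ e)) (inverseˡ (σ∈ e))) ,
      trans (cong (g ∘ inverse (lookup σ e)) (sym σₑj≡i)) (trans (cong g (inverseˡ (σ∈ e) _)) gj≡k)

    connected⇒transitive : Connected (LiftAdj E σ) → GeneratesTransitive σ
    connected⇒transitive conn i j = walk⇒InGen (conn (zero , i) (zero , j))

-- Contracting a non-loop edge e₀ from u to v.  The vertex map merge
-- identifies v with u and renumbers the remaining vertices by Fin V; the
-- other edges keep their (merged) endpoints.
module Contraction {V m : ℕ} (E : Fin (suc m) → Fin (suc V) × Fin (suc V))
                   (e₀ : Fin (suc m)) (u≢v : proj₁ (E e₀) ≢ proj₂ (E e₀)) where

  u v : Fin (suc V)
  u = proj₁ (E e₀)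
  v = proj₂ (E e₀)

  merge : Fin (suc V) → Fin V
  merge w with w ≟ v
  ... | Dec.yes _  = punchOut (u≢v ∘ sym)
  ... | Dec.no w≢v = punchOut (w≢v ∘ sym)

  merge-punchIn : ∀ w → merge (punchIn v w) ≡ w
  merge-punchIn w with punchIn v w ≟ v
  ... | Dec.yes eq = ⊥-elim (punchInᵢ≢i v w eq)
  ... | Dec.no _   = trans (punchOut-cong v refl) (punchOut-punchIn v)

  merge-u≡merge-v : merge u ≡ merge v
  merge-u≡merge-v with u ≟ v | v ≟ v
  ... | Dec.yes u≡v | _          = ⊥-elim (u≢v u≡v)
  ... | Dec.no _    | Dec.yes _  = punchOut-cong v refl
  ... | Dec.no _    | Dec.no v≢v = ⊥-elim (v≢v refl)

  merge-fibres : ∀ {w w′} → merge w ≡ merge w′ →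
                 w ≡ w′ ⊎ (w ≡ u × w′ ≡ v) ⊎ (w ≡ v × w′ ≡ u)
  merge-fibres {w} {w′} eq with w ≟ v | w′ ≟ v
  ... | Dec.yes w≡v | Dec.yes w′≡v = inj₁ (trans w≡v (sym w′≡v))
  ... | Dec.yes w≡v | Dec.no w′≢v  = inj₂ (inj₂ (w≡v , sym (punchOut-injective (u≢v ∘ sym) (w′≢v ∘ sym) eq)))
  ... | Dec.no w≢v  | Dec.yes w′≡v = inj₂ (inj₁ (punchOut-injective (w≢v ∘ sym) (u≢v ∘ sym) eq , w′≡v))
  ... | Dec.no w≢v  | Dec.no w′≢v  = inj₁ (punchOut-injective (w≢v ∘ sym) (w′≢v ∘ sym) eq)

  edge-cases : ∀ e → e ≡ e₀ ⊎ ∃ λ e′ → e ≡ punchIn e₀ e′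
  edge-cases e with e ≟ e₀
  ... | Dec.yes e≡e₀ = inj₁ e≡e₀
  ... | Dec.no e≢e₀  = inj₂ (punchOut (e≢e₀ ∘ sym) , sym (punchIn-punchOut (e≢e₀ ∘ sym)))

  source target : Fin m → Fin (suc V)
  source e′ = proj₁ (E (punchIn e₀ e′))
  target e′ = proj₂ (E (punchIn e₀ e′))

  E/e₀ : Fin m → Fin V × Fin V
  E/e₀ e′ = merge (source e′) , merge (target e′)

  e₀-merges : ∀ {x y} → E e₀ ≡ (x , y) → merge x ≡ merge y
  e₀-merges {x} {y} Ee₀≡xy = begin
    merge x ≡⟨ cong (merge ∘ proj₁) Ee₀≡xy ⟨
    merge u ≡⟨ merge-u≡merge-v ⟩
    merge v ≡⟨ cong (merge ∘ proj₂) Ee₀≡xy ⟩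
    merge y ∎

  other-edge : ∀ {e′ x y} → E (punchIn e₀ e′) ≡ (x , y) → E/e₀ e′ ≡ (merge x , merge y)
  other-edge = cong (λ xy → merge (proj₁ xy) , merge (proj₂ xy))

  contraction-connected : Connected (EdgeAdj E) → Connected (EdgeAdj E/e₀)
  contraction-connected = connected-image merge edge-image (punchIn v) merge-punchIn
    where
    edge-image : ∀ {x y} → EdgeAdj E x y → Walk (EdgeAdj E/e₀) (merge x) (merge y)
    edge-image {x} {y} (e , Ee≡xy) with edge-cases e
    ... | inj₁ refl        = subst (Walk (EdgeAdj E/e₀) (merge x)) (e₀-merges Ee≡xy) ε
    ... | inj₂ (e′ , refl) = fwd (e′ , other-edge Ee≡xy) ◅ ε

  -- Given the permutation s on e₀, relabel the fibre over v by s⁻¹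
  -- (ρ); then the e₀-edges (u , i) → (v , s i) of the lift become
  -- identifications, and the lift of E collapses onto a lift of E/e₀.
  module Lifts {n : ℕ} (s : Perm n) where

    ρ ρ⁻¹ : Fin (suc V) → Fin n → Fin n
    ρ w with w ≟ v
    ... | Dec.yes _ = inverse s
    ... | Dec.no _  = λ i → i
    ρ⁻¹ w with w ≟ v
    ... | Dec.yes _ = lookup s
    ... | Dec.no _  = λ i → i

    up down : Fin m → Perm n → Perm n
    up   e′ = relabel (ρ⁻¹ (target e′)) (ρ (source e′))
    down e′ = relabel (ρ (target e′)) (ρ⁻¹ (source e′))

    extend : Vec (Perm n) m → Vec (Perm n) (suc m)
    extend τ = insertAt (tabulate λ e′ → up e′ (lookup τ e′)) e₀ s

    contract : Vec (Perm n) m → Vec (Perm n) m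
    contract σ = tabulate λ e′ → down e′ (lookup σ e′)

    extend-e₀ : ∀ τ → lookup (extend τ) e₀ ≡ s
    extend-e₀ τ = insertAt-lookup _ e₀ s

    extend-other : ∀ τ e′ → lookup (extend τ) (punchIn e₀ e′) ≡ up e′ (lookup τ e′)
    extend-other τ e′ = trans (insertAt-punchIn _ e₀ s e′) (lookup∘tabulate _ e′)

    project : Fin (suc V) × Fin n → Fin V × Fin n
    project (w , i) = merge w , ρ w i

    module _ (s∈ : s ∈ perms n) where

      ρ-ρ⁻¹ : ∀ w i → ρ w (ρ⁻¹ w i) ≡ i
      ρ-ρ⁻¹ w i with w ≟ v
      ... | Dec.yes _ = inverseˡ s∈ i
      ... | Dec.no _  = refl

      ρ⁻¹-ρ : ∀ w i → ρ⁻¹ w (ρ w i) ≡ i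
      ρ⁻¹-ρ w i with w ≟ v
      ... | Dec.yes _ = inverseʳ s∈ i
      ... | Dec.no _  = refl

      ρ-v : ∀ i → ρ v i ≡ inverse s i
      ρ-v i with v ≟ v
      ... | Dec.yes _  = refl
      ... | Dec.no v≢v = ⊥-elim (v≢v refl)

      ρ-off-v : ∀ {w} → w ≢ v → ∀ i → ρ w i ≡ i
      ρ-off-v {w} w≢v i with w ≟ v
      ... | Dec.yes w≡v = ⊥-elim (w≢v w≡v)
      ... | Dec.no _    = refl

      ρ-injective : ∀ w → Injective _≡_ _≡_ (ρ w)
      ρ-injective w {i} {j} eq = trans (sym (ρ⁻¹-ρ w i)) (trans (cong (ρ⁻¹ w) eq) (ρ⁻¹-ρ w j))

      ρ⁻¹-injective : ∀ w → Injective _≡_ _≡_ (ρ⁻¹ w)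
      ρ⁻¹-injective w {i} {j} eq = trans (sym (ρ-ρ⁻¹ w i)) (trans (cong (ρ w) eq) (ρ-ρ⁻¹ w j))

      down-up : ∀ e′ π → down e′ (up e′ π) ≡ π
      down-up e′ π = relabel-relabel {a = ρ (target e′)} {ρ⁻¹ (target e′)} {ρ⁻¹ (source e′)} {ρ (source e′)}
                                     π (ρ-ρ⁻¹ (target e′)) (ρ-ρ⁻¹ (source e′))

      up-down : ∀ e′ π → up e′ (down e′ π) ≡ π
      up-down e′ π = relabel-relabel {a = ρ⁻¹ (target e′)} {ρ (target e′)} {ρ (source e′)} {ρ⁻¹ (source e′)}
                                     π (ρ⁻¹-ρ (target e′)) (ρ⁻¹-ρ (source e′))

      contract-extend : ∀ τ → contract (removeAt (extend τ) e₀) ≡ τ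
      contract-extend τ = begin
        contract (removeAt (extend τ) e₀)  ≡⟨ cong contract (removeAt-insertAt τ′ e₀ s) ⟩
        contract τ′                        ≡⟨ tabulate-cong (λ e′ → trans (cong (down e′) (lookup∘tabulate _ e′))
                                                                          (down-up e′ (lookup τ e′))) ⟩
        tabulate (lookup τ)                ≡⟨ tabulate∘lookup τ ⟩
        τ                                  ∎
        where
        τ′ : Vec (Perm n) m
        τ′ = tabulate λ e′ → up e′ (lookup τ e′)

      extend-contract : ∀ σ → lookup σ e₀ ≡ s → extend (contract (removeAt σ e₀)) ≡ σ
      extend-contract σ σe₀≡s = begin
        extend (contract σ′)          ≡⟨ cong₂ (λ τ t → insertAt τ e₀ t) undo (sym σe₀≡s) ⟩
        insertAt σ′ e₀ (lookup σ e₀)  ≡⟨ insertAt-removeAt σ e₀ ⟩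
        σ                             ∎
        where
        σ′ : Vec (Perm n) m
        σ′ = removeAt σ e₀
        undo : tabulate (λ e′ → up e′ (lookup (contract σ′) e′)) ≡ σ′
        undo = trans (tabulate-cong λ e′ → trans (cong (up e′) (lookup∘tabulate _ e′)) (up-down e′ (lookup σ′ e′)))
                     (tabulate∘lookup σ′)

      -- For every τ, the lift of E by extend τ is connected iff the lift of
      -- E/e₀ by τ is: project is onto, sends edges to edges (e₀-edges to
      -- points), edges of the lift of E/e₀ lift back, and its fibres are
      -- single points or e₀-edges.
      module _ (τ : Vec (Perm n) m) where

        edge-image : ∀ {x y} → LiftAdj E (extend τ) x y → Walk (LiftAdj E/e₀ τ) (project x) (project y)
        edge-image {x , i} {y , j} (e , Ee≡xy , σₑi≡j) with edge-cases e
        ... | inj₁ refl = subst (Walk (LiftAdj E/e₀ τ) (project (x , i))) (cong₂ _,_ (e₀-merges Ee≡xy) ρx-i≡ρy-j) ε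
          where
          ρx-i≡ρy-j : ρ x i ≡ ρ y j
          ρx-i≡ρy-j = begin
            ρ x i                                         ≡⟨ ρ-off-v (λ x≡v → u≢v (trans (cong proj₁ Ee≡xy) x≡v)) i ⟩
            i                                             ≡⟨ inverseˡ s∈ i ⟨
            inverse s (lookup s i)                        ≡⟨ cong (λ π → inverse s (lookup π i)) (extend-e₀ τ) ⟨
            inverse s (lookup (lookup (extend τ) e₀) i)   ≡⟨ cong (inverse s) σₑi≡j ⟩
            inverse s j                                   ≡⟨ ρ-v j ⟨
            ρ v j                                         ≡⟨ cong (λ w → ρ w j) (cong proj₂ Ee≡xy) ⟩
            ρ y j                                         ∎
        ... | inj₂ (e′ , refl) =
          fwd (e′ , other-edge Ee≡xy , τ-step) ◅ ε
          where
          τ-step : lookup (lookup τ e′) (ρ x i) ≡ ρ y j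
          τ-step = begin
            lookup (lookup τ e′) (ρ x i)
              ≡⟨ ρ-ρ⁻¹ y _ ⟨
            ρ y (ρ⁻¹ y (lookup (lookup τ e′) (ρ x i)))
              ≡⟨ cong (λ xy → ρ y (ρ⁻¹ (proj₂ xy) (lookup (lookup τ e′) (ρ (proj₁ xy) i)))) Ee≡xy ⟨
            ρ y (ρ⁻¹ (target e′) (lookup (lookup τ e′) (ρ (source e′) i)))
              ≡⟨ cong (ρ y) (lookup-relabel (ρ⁻¹ (target e′)) (ρ (source e′)) (lookup τ e′) i) ⟨
            ρ y (lookup (up e′ (lookup τ e′)) i)
              ≡⟨ cong (λ π → ρ y (lookup π i)) (extend-other τ e′) ⟨
            ρ y (lookup (lookup (extend τ) (punchIn e₀ e′)) i)
              ≡⟨ cong (ρ y) σₑi≡j ⟩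
            ρ y j ∎

        edge-lift : ∀ {b b′} → LiftAdj E/e₀ τ b b′ →
                    ∃₂ λ x y → LiftAdj E (extend τ) x y × project x ≡ b × project y ≡ b′
        edge-lift {w , i} {w′ , j} (e′ , E/e₀e′≡ww′ , τi≡j) =
          (source e′ , ρ⁻¹ (source e′) i) , (target e′ , ρ⁻¹ (target e′) j) ,
          (punchIn e₀ e′ , refl , lifted) ,
          cong₂ _,_ (cong proj₁ E/e₀e′≡ww′) (ρ-ρ⁻¹ (source e′) i) ,
          cong₂ _,_ (cong proj₂ E/e₀e′≡ww′) (ρ-ρ⁻¹ (target e′) j)
          where
          lifted : lookup (lookup (extend τ) (punchIn e₀ e′)) (ρ⁻¹ (source e′) i) ≡ ρ⁻¹ (target e′) j
          lifted = begin
            lookup (lookup (extend τ) (punchIn e₀ e′)) (ρ⁻¹ (source e′) i)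
              ≡⟨ cong (λ π → lookup π (ρ⁻¹ (source e′) i)) (extend-other τ e′) ⟩
            lookup (up e′ (lookup τ e′)) (ρ⁻¹ (source e′) i)
              ≡⟨ lookup-relabel (ρ⁻¹ (target e′)) (ρ (source e′)) (lookup τ e′) _ ⟩
            ρ⁻¹ (target e′) (lookup (lookup τ e′) (ρ (source e′) (ρ⁻¹ (source e′) i)))
              ≡⟨ cong (ρ⁻¹ (target e′) ∘ lookup (lookup τ e′)) (ρ-ρ⁻¹ (source e′) i) ⟩
            ρ⁻¹ (target e′) (lookup (lookup τ e′) i)
              ≡⟨ cong (ρ⁻¹ (target e′)) τi≡j ⟩
            ρ⁻¹ (target e′) j ∎

        e₀-joins : ∀ {i j} → project (u , i) ≡ project (v , j) → lookup (lookup (extend τ) e₀) i ≡ j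
        e₀-joins {i} {j} same = begin
          lookup (lookup (extend τ) e₀) i ≡⟨ cong (λ π → lookup π i) (extend-e₀ τ) ⟩
          lookup s i                      ≡⟨ cong (lookup s) (ρ-off-v u≢v i) ⟨
          lookup s (ρ u i)                ≡⟨ cong (lookup s ∘ proj₂) same ⟩
          lookup s (ρ v j)                ≡⟨ cong (lookup s) (ρ-v j) ⟩
          lookup s (inverse s j)          ≡⟨ inverseʳ s∈ j ⟩
          j                               ∎

        fibre-connected : ∀ {x y} → project x ≡ project y → Walk (LiftAdj E (extend τ)) x y
        fibre-connected {w , i} {w′ , j} same with merge-fibres {w} {w′} (cong proj₁ same)
        ... | inj₁ refl = subst (Walk (LiftAdj E (extend τ)) (w , i) ∘ (w ,_)) (ρ-injective w (cong proj₂ same)) ε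
        ... | inj₂ (inj₁ (refl , refl)) = fwd (e₀ , refl , e₀-joins same) ◅ ε
        ... | inj₂ (inj₂ (refl , refl)) = bwd (e₀ , refl , e₀-joins (sym same)) ◅ ε

        project-section : ∀ b → project (punchIn v (proj₁ b) , proj₂ b) ≡ b
        project-section (w , i) = cong₂ _,_ (merge-punchIn w) (ρ-off-v (punchInᵢ≢i v w) i)

        extend-connected⇔ : Connected (LiftAdj E (extend τ)) ⇔ Connected (LiftAdj E/e₀ τ)
        extend-connected⇔ =
          mk⇔ (connected-image project edge-image (λ b → punchIn v (proj₁ b) , proj₂ b) project-section)
              (connected-preimage project edge-lift fibre-connected)

      extend∈ : ∀ τ → (∀ e′ → lookup τ e′ ∈ perms n) → ∀ e → lookup (extend τ) e ∈ perms n
      extend∈ τ τ∈ e with edge-cases e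
      ... | inj₁ refl        = subst (_∈ perms n) (sym (extend-e₀ τ)) s∈
      ... | inj₂ (e′ , refl) = subst (_∈ perms n) (sym (extend-other τ e′))
                                     (relabel∈perms (ρ⁻¹-injective (target e′)) (ρ-injective (source e′)) (τ∈ e′))

      contract∈ : ∀ σ → (∀ e → lookup σ e ∈ perms n) → ∀ e′ → lookup (contract (removeAt σ e₀)) e′ ∈ perms n
      contract∈ σ σ∈ e′ = subst (_∈ perms n) (sym (lookup∘tabulate _ e′))
        (relabel∈perms (ρ-injective (target e′)) (ρ⁻¹-injective (source e′))
                       (subst (_∈ perms n) (sym (lookup-removeAt σ e₀ e′)) (σ∈ (punchIn e₀ e′))))

  module Assignments (n : ℕ) where

    Assignment : ℕ → Set
    Assignment k = Vec (Perm n) k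

    join : Assignment (suc m) → Assignment (suc m)
    join (s ∷ᵥ τ) = Lifts.extend s τ

    split : Assignment (suc m) → Assignment (suc m)
    split σ = lookup σ e₀ ∷ᵥ Lifts.contract (lookup σ e₀) (removeAt σ e₀)

    join∈ : ∀ {σ} → σ ∈ vecsOf (perms n) (suc m) → join σ ∈ vecsOf (perms n) (suc m)
    join∈ {s ∷ᵥ τ} σ∈ = ∈-vecsOf⁺ (Lifts.extend∈ s (∈-vecsOf⁻ σ∈ zero) τ (∈-vecsOf⁻ σ∈ ∘ suc))

    split∈ : ∀ {σ} → σ ∈ vecsOf (perms n) (suc m) → split σ ∈ vecsOf (perms n) (suc m)
    split∈ {σ} σ∈ = ∈-vecsOf⁺ λ
      { zero     → ∈-vecsOf⁻ σ∈ e₀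
      ; (suc e′) → Lifts.contract∈ (lookup σ e₀) (∈-vecsOf⁻ σ∈ e₀) σ (∈-vecsOf⁻ σ∈) e′ }

    join-split : ∀ {σ} → σ ∈ vecsOf (perms n) (suc m) → join (split σ) ≡ σ
    join-split {σ} σ∈ = Lifts.extend-contract (lookup σ e₀) (∈-vecsOf⁻ σ∈ e₀) σ refl

    split-join : ∀ {σ} → σ ∈ vecsOf (perms n) (suc m) → split (join σ) ≡ σ
    split-join {s ∷ᵥ τ} σ∈ = begin
      split (Lifts.extend s τ)
        ≡⟨ cong (λ t → t ∷ᵥ Lifts.contract t (removeAt (Lifts.extend s τ) e₀)) (Lifts.extend-e₀ s τ) ⟩
      s ∷ᵥ Lifts.contract s (removeAt (Lifts.extend s τ) e₀)
        ≡⟨ cong (s ∷ᵥ_) (Lifts.contract-extend s (∈-vecsOf⁻ σ∈ zero) τ) ⟩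
      s ∷ᵥ τ ∎

  count-connected-lifts : ∀ n {a} →
    Count (λ σ → Connected (LiftAdj E σ)) (vecsOf (perms n) (suc m)) a →
    ∃ λ c → Count (λ τ → Connected (LiftAdj E/e₀ τ)) (vecsOf (perms n) m) c × a ≡ length (perms n) * c
  count-connected-lifts n {a} connected =
    factorise (Count-product-factor _∷ᵥ_ (perms n) (vecsOf (perms n) m) same-connectivity
                 (tabulate∈perms {f = λ i → i} (λ eq → eq)) joined)
    where
    open Assignments n
    joined : Count (λ σ → Connected (LiftAdj E (join σ))) (cartesianProductWith _∷ᵥ_ (perms n) (vecsOf (perms n) m)) a
    joined = subst (λ σs → Count (λ σ → Connected (LiftAdj E (join σ))) σs a) (vecsOf-suc (perms n) m)
      (Count-bijection split join (vecsOf-unique (suc m) (perms-unique n)) split∈ join∈ split-join join-split connected)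
    same-connectivity : ∀ {s τ} → s ∈ perms n → τ ∈ vecsOf (perms n) m →
                        Connected (LiftAdj E (join (s ∷ᵥ τ))) ⇔ Connected (LiftAdj E/e₀ τ)
    same-connectivity {s} {τ} s∈ _ = Lifts.extend-connected⇔ s s∈ τ
    factorise : (∃ λ c → Count (λ τ → Connected (LiftAdj E/e₀ τ)) (vecsOf (perms n) m) c) →
                ∃ λ c → Count (λ τ → Connected (LiftAdj E/e₀ τ)) (vecsOf (perms n) m) c × a ≡ length (perms n) * c
    factorise (c , connected/e₀) =
      c , connected/e₀ , Count-product _∷ᵥ_ (perms n) (vecsOf (perms n) m) same-connectivity connected/e₀ joined

-- The cyclomatic condition m + 1 ≡ (V + 1) + l is preserved by contraction.
connected-lifts-count : ∀ V {m l n} (E : Fin m → Fin (suc V) × Fin (suc V)) →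
  Connected (EdgeAdj E) → m + 1 ≡ suc V + l → ∀ {a b} →
  Count (λ σ → Connected (LiftAdj E σ)) (vecsOf (perms n) m) a →
  Count GeneratesTransitive (vecsOf (perms n) l) b →
  a * length (perms n) ^ l ≡ b * length (perms n) ^ m
connected-lifts-count zero {m} {n = n} E _ m+1≡1+l connected transitive
  with refl ← suc-injective (trans (sym (+-comm m 1)) m+1≡1+l) =
  cong (_* length (perms n) ^ m) (Count-functional (Count-cong lift⇔gen connected) transitive)
  where
  lift⇔gen : ∀ {σ} → σ ∈ vecsOf (perms n) m → Connected (LiftAdj E σ) ⇔ GeneratesTransitive σ
  lift⇔gen {σ} σ∈ = mk⇔ (OneVertexLift.connected⇒transitive E σ (∈-vecsOf⁻ σ∈))
                        (OneVertexLift.transitive⇒connected E σ)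
connected-lifts-count (suc V) {zero} E conn _ _ _
  with () , _ ← walk⇒non-loop (conn zero (suc zero)) (λ ())
connected-lifts-count (suc V) {suc m} {l} {n} E conn m+1≡V+l {a} {b} connected transitive
  with e₀ , u≢v ← walk⇒non-loop (conn zero (suc zero)) (λ ())
  with c , connected/e₀ , a≡Lc ← Contraction.count-connected-lifts E e₀ u≢v n connected = begin
  a * L ^ l          ≡⟨ cong (_* L ^ l) a≡Lc ⟩
  L * c * L ^ l      ≡⟨ *-assoc L c (L ^ l) ⟩
  L * (c * L ^ l)    ≡⟨ cong (L *_) contracted ⟩
  L * (b * L ^ m)    ≡⟨ x∙yz≈y∙xz L b (L ^ m) ⟩
  b * (L * L ^ m)    ∎
  where
  open Contraction E e₀ u≢v
  L : ℕ
  L = length (perms n)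
  contracted : c * L ^ l ≡ b * L ^ m
  contracted = connected-lifts-count V E/e₀ (contraction-connected conn) (suc-injective m+1≡V+l)
                                     connected/e₀ transitive

-- Lemma 4.3.
lemma4p3 : (V m l n : ℕ) (E : Fin m → Fin V × Fin V) →
    1 ≤ l → 1 ≤ V → Simple E → Connected (EdgeAdj E) → m + 1 ≡ V + l →
    (a b : ℕ) →
    Count (λ σ → Connected (LiftAdj E σ)) (vecsOf (perms n) m) a →
    Count GeneratesTransitive (vecsOf (perms n) l) b →
    a * length (perms n) ^ l ≡ b * length (perms n) ^ m
lemma4p3 zero    m l n E _ () _ _ _ _ _
lemma4p3 (suc V) m l n E _ _ _ conn m+1≡V+l a b = connected-lifts-count V E conn m+1≡V+l
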